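{- Let $S$ be a monoid with regular core $R$. (1) If $r\in R$, $e\in S$, $e^2=e$ and $rS=eS$, then $e\in R$ and $rR=eR$. (2) If $e,f\in R$ with $e^2=e$ and $f^2=f$, then $eS=fS$ if and only if $eR=fR$.
   Context: Let $S$ be a monoid. A (left) $S$-polygon is a set $A$ with a map $S\times A\to A$, $(s,a)\mapsto sa$, such that $s_1(s_2a)=(s_1s_2)a$ and $1a=a$; homomorphisms and subpolygons are defined in the obvious way, and for $a\in A$ we write $Sa=\{sa\mid s\in S\}$. The monoid $S$ is itself an $S$-polygon ${}_SS$ under left multiplication. An element $a$ of a polygon $A$ is act-regular if there is a polygon homomorphism $\varphi:Sa\to S$ with $\varphi(a)a=a$ (equivalently, $Sa\cong Se$ as polygons for some idempotent $e\in S$, via an isomorphism sending $a$ to $e$); $A$ is regular if all its elements are act-regular. The regular core $R$ of $S$ is the union of all regular subpolygons of ${}_SS$, i.e. the set of $a\in S$ such that the polygon $Sa$ is regular; it is assumed nonempty, and it is a subsemigroup of $S$. -}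

module Defs where

open import Level using (_⊔_)
open import Algebra.Bundles using (Monoid)
open import Data.Product using (Σ; ∃; _×_; _,_; proj₁)

module _ {c ℓ} (M : Monoid c ℓ) where
  open Monoid M

  InCyclic : Carrier → Carrier → Set (c ⊔ ℓ)
  InCyclic a x = ∃ λ s → x ≈ s ∙ a

  Cyclic : Carrier → Set (c ⊔ ℓ)
  Cyclic a = Σ Carrier (InCyclic a)

  act : ∀ {a} → Carrier → Cyclic a → Cyclic a
  act {a} s (x , (t , p)) = s ∙ x , (s ∙ t , trans (∙-congˡ p) (sym (assoc s t a)))

  gen : ∀ a → Cyclic a
  gen a = a , (ε , sym (identityˡ a))

  IsHom : ∀ a → (Cyclic a → Carrier) → Set (c ⊔ ℓ)
  IsHom a φ = (∀ u v → proj₁ u ≈ proj₁ v → φ u ≈ φ v)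
            × (∀ s u → φ (act s u) ≈ s ∙ φ u)

  ActRegular : Carrier → Set (c ⊔ ℓ)
  ActRegular a = ∃ λ (φ : Cyclic a → Carrier) → IsHom a φ × (φ (gen a) ∙ a ≈ a)

  -- a ∈ R (regular core): the polygon Sa is regular
  InCore : Carrier → Set (c ⊔ ℓ)
  InCore a = ∀ b → InCyclic a b → ActRegular b

  Idempotent : Carrier → Set ℓ
  Idempotent e = e ∙ e ≈ e

  InRightS : Carrier → Carrier → Set (c ⊔ ℓ)
  InRightS a x = ∃ λ s → x ≈ a ∙ s

  InRightR : Carrier → Carrier → Set (c ⊔ ℓ)
  InRightR a x = ∃ λ s → InCore s × x ≈ a ∙ s

  SameSet : (Carrier → Set (c ⊔ ℓ)) → (Carrier → Set (c ⊔ ℓ)) → Set (c ⊔ ℓ)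
  SameSet P Q = ∀ x → (P x → Q x) × (Q x → P x)

-- Act-regularity transfers between ℛ-related elements: if a = b r and b = a s, then precomposing a
-- splitting φ : Sa → S with right multiplication by r (which maps Sb into Sa) splits b.  Hence the
-- regular core, being closed under left multiplication, is closed under ℛ, and rS = eS gives rR = eR
-- because r and e divide each other on the right.
-- Conversely e = e e ∈ eR when e ∈ R is idempotent, so eR = fR gives e ∈ fS and f ∈ eS.
module Submission where

open import Defs
open import Algebra.Bundles using (Monoid)
open import Data.Product using (_×_; _,_; proj₁; proj₂)
import Relation.Binary.Reasoning.Setoid as SetoidReasoning

module _ {c ℓ} (M : Monoid c ℓ) where
  open Monoid M
  open SetoidReasoning setoid

  actRegular-resp-ℛ : ∀ {a b r s} → ActRegular M a → a ≈ b ∙ r → b ≈ a ∙ s → ActRegular M b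
  actRegular-resp-ℛ {a} {b} {r} {s} (φ , (φ-cong , φ-hom) , φa∙a≈a) a≈br b≈as =
    ψ , (ψ-cong , ψ-hom) , ψb∙b≈b
    where
    ψ : Cyclic M b → Carrier
    ψ (x , w , x≈wb) = φ (x ∙ r , w , (begin
      x ∙ r       ≈⟨ ∙-congʳ x≈wb ⟩
      (w ∙ b) ∙ r ≈⟨ assoc w b r ⟩
      w ∙ (b ∙ r) ≈⟨ ∙-congˡ a≈br ⟨
      w ∙ a       ∎))

    ψ-cong : ∀ u v → proj₁ u ≈ proj₁ v → ψ u ≈ ψ v
    ψ-cong _ _ u≈v = φ-cong _ _ (∙-congʳ u≈v)

    ψ-hom : ∀ t u → ψ (act M t u) ≈ t ∙ ψ u
    ψ-hom t (x , _) = trans (φ-cong _ _ (assoc t x r)) (φ-hom t _)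

    ψb∙b≈b : ψ (gen M b) ∙ b ≈ b
    ψb∙b≈b = begin
      ψ (gen M b) ∙ b       ≈⟨ ∙-congʳ (φ-cong _ (gen M a) (sym a≈br)) ⟩
      φ (gen M a) ∙ b       ≈⟨ ∙-congˡ b≈as ⟩
      φ (gen M a) ∙ (a ∙ s) ≈⟨ assoc _ _ _ ⟨
      (φ (gen M a) ∙ a) ∙ s ≈⟨ ∙-congʳ φa∙a≈a ⟩
      a ∙ s                 ≈⟨ b≈as ⟨
      b                     ∎

  inCore-∙ˡ : ∀ {x y} → InCore M y → InCore M (x ∙ y)
  inCore-∙ˡ {x} {y} y∈R b (u , b≈uxy) = y∈R b (u ∙ x , trans b≈uxy (sym (assoc u x y)))

  inCore-resp-ℛ : ∀ {r e} → InCore M r → InRightS M r e → InRightS M e r → InCore M e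
  inCore-resp-ℛ {r} {e} r∈R (s , e≈rs) (t , r≈et) b (u , b≈ue) =
    actRegular-resp-ℛ (r∈R (u ∙ r) (u , refl)) ur≈bt b≈urs
    where
    ur≈bt : u ∙ r ≈ b ∙ t
    ur≈bt = begin
      u ∙ r       ≈⟨ ∙-congˡ r≈et ⟩
      u ∙ (e ∙ t) ≈⟨ assoc u e t ⟨
      (u ∙ e) ∙ t ≈⟨ ∙-congʳ b≈ue ⟨
      b ∙ t       ∎

    b≈urs : b ≈ (u ∙ r) ∙ s
    b≈urs = begin
      b           ≈⟨ b≈ue ⟩
      u ∙ e       ≈⟨ ∙-congˡ e≈rs ⟩
      u ∙ (r ∙ s) ≈⟨ assoc u r s ⟨
      (u ∙ r) ∙ s ∎

  inRightS-refl : ∀ a → InRightS M a a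
  inRightS-refl a = ε , sym (identityʳ a)

  inRightS-trans : ∀ {a b x} → InRightS M b a → InRightS M a x → InRightS M b x
  inRightS-trans {a} {b} (s , a≈bs) (y , x≈ay) =
    s ∙ y , trans x≈ay (trans (∙-congʳ a≈bs) (assoc b s y))

  inRightR-trans : ∀ {a b x} → InRightS M b a → InRightR M a x → InRightR M b x
  inRightR-trans {a} {b} (s , a≈bs) (y , y∈R , x≈ay) =
    s ∙ y , inCore-∙ˡ y∈R , trans x≈ay (trans (∙-congʳ a≈bs) (assoc b s y))

  sameRightS⇒sameRightR : ∀ {a b} → SameSet M (InRightS M a) (InRightS M b) →
                          SameSet M (InRightR M a) (InRightR M b)
  sameRightS⇒sameRightR {a} {b} aS≡bS x =
    inRightR-trans (proj₁ (aS≡bS a) (inRightS-refl a)) ,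
    inRightR-trans (proj₂ (aS≡bS b) (inRightS-refl b))

  sameRightS⇒inCore : ∀ {r e} → InCore M r → SameSet M (InRightS M r) (InRightS M e) → InCore M e
  sameRightS⇒inCore {r} {e} r∈R rS≡eS =
    inCore-resp-ℛ r∈R (proj₂ (rS≡eS e) (inRightS-refl e)) (proj₁ (rS≡eS r) (inRightS-refl r))

  idempotent∈rightR : ∀ {e} → InCore M e → Idempotent M e → InRightR M e e
  idempotent∈rightR e∈R ee≈e = _ , e∈R , sym ee≈e

  inRightR⇒inRightS : ∀ {a x} → InRightR M a x → InRightS M a x
  inRightR⇒inRightS (y , _ , x≈ay) = y , x≈ay

  sameRightR⇒sameRightS : ∀ {e f} → InCore M e → InCore M f → Idempotent M e → Idempotent M f →
                          SameSet M (InRightR M e) (InRightR M f) →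
                          SameSet M (InRightS M e) (InRightS M f)
  sameRightR⇒sameRightS {e} {f} e∈R f∈R ee≈e ff≈f eR≡fR x =
    inRightS-trans (inRightR⇒inRightS (proj₁ (eR≡fR e) (idempotent∈rightR e∈R ee≈e))) ,
    inRightS-trans (inRightR⇒inRightS (proj₂ (eR≡fR f) (idempotent∈rightR f∈R ff≈f)))

proposition2p4 : ∀ {c ℓ} (M : Monoid c ℓ) →
    (∀ r e → InCore M r → Idempotent M e →
      SameSet M (InRightS M r) (InRightS M e) →
      InCore M e × SameSet M (InRightR M r) (InRightR M e))
    × (∀ e f → InCore M e → InCore M f → Idempotent M e → Idempotent M f →
      (SameSet M (InRightS M e) (InRightS M f) → SameSet M (InRightR M e) (InRightR M f))
      × (SameSet M (InRightR M e) (InRightR M f) → SameSet M (InRightS M e) (InRightS M f)))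
proposition2p4 M =
  (λ _ _ r∈R _ rS≡eS → sameRightS⇒inCore M r∈R rS≡eS , sameRightS⇒sameRightR M rS≡eS) ,
  (λ _ _ e∈R f∈R ee≈e ff≈f → sameRightS⇒sameRightR M , sameRightR⇒sameRightS M e∈R f∈R ee≈e ff≈f)
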